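{- Any two graphs in $\mathcal{A}$ are connected by a path in $\mathcal{G}_6^*$.
   Context: $\mathcal{G}_6$ is the set of simple 3-regular graphs on vertex set $\{1,\dots,6\}$. A make move ${\tt make}(yxvwz)$ applies to $G=(V,E)$ when $y,x,v,w,z$ are distinct, $yx,xv,vw,wz\in E$ and $xw,yz\notin E$, and replaces $E$ by $(E\setminus\{xy,wz\})\cup\{xw,yz\}$. A break move ${\tt break}(vxw,yz)$ applies when $vxwv$ is a triangle, $yz\in E$, $\{y,z\}\cap\{v,x,w\}=\emptyset$ and $xy,wz\notin E$, and replaces $E$ by $(E\setminus\{xw,yz\})\cup\{xy,wz\}$. $\mathcal{G}_6^*$ is the graph on vertex set $\mathcal{G}_6$ with $G,G'$ adjacent iff a make or break move takes $G$ to $G'$. $\mathcal{A}$ is the set of graphs in $\mathcal{G}_6$ isomorphic to $K_{3,3}$. -}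

module Defs where

open import Data.Bool using (Bool; true; false; T)
open import Data.Nat using (ℕ; _<_)
open import Data.Fin using (Fin; toℕ)
open import Data.Fin.Permutation using (Permutation′; _⟨$⟩ʳ_)
open import Data.List using (length; filterᵇ; allFin)
open import Data.Product using (Σ; _×_; ∃)
open import Data.Sum using (_⊎_)
open import Data.Empty using (⊥)
open import Relation.Nullary using (¬_)
open import Relation.Binary.PropositionalEquality using (_≡_; _≢_)
open import Function.Bundles using (_⇔_)
open import Relation.Binary.Construct.Closure.ReflexiveTransitive using (Star)

-- Vertex set {1,...,6}, represented as Fin 6 (vertex i+1 ↦ i).
V : Set
V = Fin 6

record Graph : Set where
  field
    adj   : V → V → Bool
    sym   : ∀ a b → adj a b ≡ adj b a
    irr   : ∀ a → adj a a ≡ false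
    cubic : ∀ a → length (filterᵇ (adj a) (allFin 6)) ≡ 3
open Graph public

E : Graph → V → V → Set
E G a b = T (adj G a b)

SamePair : V → V → V → V → Set
SamePair a b p q = (a ≡ p × b ≡ q) ⊎ (a ≡ q × b ≡ p)

Replaces : Graph → Graph → V → V → V → V → V → V → V → V → Set
Replaces G G' p₁ q₁ p₂ q₂ r₁ s₁ r₂ s₂ =
  ∀ a b → E G' a b ⇔
    ((E G a b × ¬ SamePair a b p₁ q₁ × ¬ SamePair a b p₂ q₂)
      ⊎ SamePair a b r₁ s₁ ⊎ SamePair a b r₂ s₂)

Distinct5 : V → V → V → V → V → Set
Distinct5 a b c d e =
  a ≢ b × a ≢ c × a ≢ d × a ≢ e × b ≢ c × b ≢ d × b ≢ e × c ≢ d × c ≢ e × d ≢ e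

Make : Graph → V → V → V → V → V → Graph → Set
Make G y x v w z G' =
  Distinct5 y x v w z × E G y x × E G x v × E G v w × E G w z
  × ¬ E G x w × ¬ E G y z
  × Replaces G G' x y w z x w y z

Break : Graph → V → V → V → V → V → Graph → Set
Break G v x w y z G' =
  (v ≢ x × x ≢ w × w ≢ v × E G v x × E G x w × E G w v)
  × E G y z
  × (y ≢ v × y ≢ x × y ≢ w × z ≢ v × z ≢ x × z ≢ w)
  × ¬ E G x y × ¬ E G w z
  × Replaces G G' x w y z x y w z

Move : Graph → Graph → Set
Move G G' =
  (Σ V λ y → Σ V λ x → Σ V λ v → Σ V λ w → Σ V λ z → Make G y x v w z G')
  ⊎ (Σ V λ v → Σ V λ x → Σ V λ w → Σ V λ y → Σ V λ z → Break G v x w y z G')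

Adj* : Graph → Graph → Set
Adj* G G' = Move G G' ⊎ Move G' G

Connected* : Graph → Graph → Set
Connected* = Star Adj*

K33 : V → V → Set
K33 a b = (toℕ a < 3 × ¬ (toℕ b < 3)) ⊎ (¬ (toℕ a < 3) × toℕ b < 3)

IsK33 : Graph → Set
IsK33 G = Σ (Permutation′ 6) λ π → ∀ a b → E G (π ⟨$⟩ʳ a) (π ⟨$⟩ʳ b) ⇔ K33 a b

module Submission where

-- The proof is a symmetry argument.  Moves are defined purely in terms of
-- adjacency, so they commute with relabelling the vertices by a permutation
-- σ of V (`move-iso`); relabelling a path gives a path (`relabel-path`).
-- Fix the standard copy K₀ with parts {0,1,2},{3,4,5}, and call σ
-- *reachable* if K₀ is joined to some σ-relabelling of K₀.  Transporting
-- paths shows that reachable permutations are closed under composition.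
-- Every automorphism of K₀ is reachable (empty path), and the transposition
-- (2 3) exchanging one vertex of each part is reachable by an explicit
-- two-move path.  Every transposition either preserves the parts or is
-- conjugate to (2 3) by an automorphism (a finite check), so every
-- transposition, and hence — since transpositions generate the symmetric
-- group — every permutation is reachable.  A graph in 𝒜 is a relabelling
-- of K₀ by definition, so it is joined to K₀, and two such graphs are
-- joined through K₀.

open import Defs
import Algebra.Properties.CommutativeMonoid.Sum
open import Data.Bool using (Bool; true; false; if_then_else_; _∧_; _∨_; _xor_) renaming (_≟_ to _≟ᴮ_)
open import Data.Bool.ListAction using (any)
open import Data.Fin using (Fin; toℕ; _≟_; #_)
import Data.Fin as Fin
open import Data.Fin.Patterns using (2F; 3F)
open import Data.Fin.Permutation
  using (Permutation′; _⟨$⟩ʳ_; _⟨$⟩ˡ_; inverseˡ; inverseʳ; transpose; _∘ₚ_; id; flip)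
  renaming (_≈_ to _≈ₚ_)
open import Data.Fin.Permutation.Transposition.List
  using (TranspositionList; eval; decompose; eval-decompose)
open import Data.Fin.Properties using (all?)
open import Data.List using (List; []; _∷_; length; filterᵇ; allFin; tabulate)
open import Data.Nat using (ℕ; zero; suc; _<?_; _<ᵇ_) renaming (_≟_ to _≟ℕ_)
open import Data.Nat.Properties using (+-0-commutativeMonoid)
open import Data.Product using (Σ; _×_; _,_)
open import Data.Product.Function.NonDependent.Propositional using (_×-⇔_)
open import Data.Sum using (_⊎_; inj₁; inj₂; swap; [_,_]′)
open import Data.Sum.Function.Propositional using (_⊎-⇔_)
import Function
open import Function using (_∘_)
open import Function.Bundles using (_⇔_; mk⇔; Equivalence)
import Function.Properties.Equivalence as ⇔
open import Relation.Binary.Construct.Closure.ReflexiveTransitive using (ε; _◅_; _◅◅_; reverse)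
open import Relation.Binary.PropositionalEquality as ≡ using (_≡_; _≢_; refl; cong; subst₂)
open import Relation.Nullary using (¬_; Dec; does)
open import Relation.Nullary.Decidable
  using (True; toWitness; from-yes; T?; ¬?; _×-dec_; _⊎-dec_; _→-dec_; map′)

open Equivalence using (to; from)

_⇔?_ : {A B : Set} → Dec A → Dec B → Dec (A ⇔ B)
a? ⇔? b? = map′ (λ (f , g) → mk⇔ f g) (λ e → to e , from e) ((a? →-dec b?) ×-dec (b? →-dec a?))

edge? : (G : Graph) (a b : V) → Dec (E G a b)
edge? G a b = T? (adj G a b)

samePair? : (a b p q : V) → Dec (SamePair a b p q)
samePair? a b p q = ((a ≟ p) ×-dec (b ≟ q)) ⊎-dec ((a ≟ q) ×-dec (b ≟ p))

replaces? : (G G' : Graph) (p₁ q₁ p₂ q₂ r₁ s₁ r₂ s₂ : V) → Dec (Replaces G G' p₁ q₁ p₂ q₂ r₁ s₁ r₂ s₂)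
replaces? G G' p₁ q₁ p₂ q₂ r₁ s₁ r₂ s₂ = all? λ a → all? λ b →
  edge? G' a b ⇔? ((edge? G a b ×-dec ¬? (samePair? a b p₁ q₁) ×-dec ¬? (samePair? a b p₂ q₂))
                   ⊎-dec samePair? a b r₁ s₁ ⊎-dec samePair? a b r₂ s₂)

distinct5? : (a b c d e : V) → Dec (Distinct5 a b c d e)
distinct5? a b c d e =
  ¬? (a ≟ b) ×-dec ¬? (a ≟ c) ×-dec ¬? (a ≟ d) ×-dec ¬? (a ≟ e) ×-dec ¬? (b ≟ c) ×-dec
  ¬? (b ≟ d) ×-dec ¬? (b ≟ e) ×-dec ¬? (c ≟ d) ×-dec ¬? (c ≟ e) ×-dec ¬? (d ≟ e)

make? : (G : Graph) (y x v w z : V) (G' : Graph) → Dec (Make G y x v w z G')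
make? G y x v w z G' =
  distinct5? y x v w z ×-dec edge? G y x ×-dec edge? G x v ×-dec edge? G v w ×-dec edge? G w z
  ×-dec ¬? (edge? G x w) ×-dec ¬? (edge? G y z) ×-dec replaces? G G' x y w z x w y z

break? : (G : Graph) (v x w y z : V) (G' : Graph) → Dec (Break G v x w y z G')
break? G v x w y z G' =
  (¬? (v ≟ x) ×-dec ¬? (x ≟ w) ×-dec ¬? (w ≟ v) ×-dec edge? G v x ×-dec edge? G x w ×-dec edge? G w v)
  ×-dec edge? G y z
  ×-dec (¬? (y ≟ v) ×-dec ¬? (y ≟ x) ×-dec ¬? (y ≟ w) ×-dec ¬? (z ≟ v) ×-dec ¬? (z ≟ x) ×-dec ¬? (z ≟ w))
  ×-dec ¬? (edge? G x y) ×-dec ¬? (edge? G w z)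
  ×-dec replaces? G G' x w y z x y w z

make⟶ : (G : Graph) (y x v w z : V) (G' : Graph) {ok : True (make? G y x v w z G')} → Adj* G G'
make⟶ G y x v w z G' {ok} = inj₁ (inj₁ (y , x , v , w , z , toWitness ok))

break⟶ : (G : Graph) (v x w y z : V) (G' : Graph) {ok : True (break? G v x w y z G')} → Adj* G G'
break⟶ G v x w y z G' {ok} = inj₁ (inj₂ (v , x , w , y , z , toWitness ok))

infixr 2 _⟶⟨_⟩_
infix  3 _■

_⟶⟨_⟩_ : ∀ G {H K} → Adj* G H → Connected* H K → Connected* G K
G ⟶⟨ step ⟩ path = step ◅ path

_■ : ∀ G → Connected* G G
G ■ = ε

IsCubic : (V → V → Bool) → Set
IsCubic f = (∀ a b → f a b ≡ f b a) × (∀ a → f a a ≡ false)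
          × (∀ a → length (filterᵇ (f a) (allFin 6)) ≡ 3)

isCubic? : (f : V → V → Bool) → Dec (IsCubic f)
isCubic? f = (all? λ a → all? λ b → f a b ≟ᴮ f b a)
       ×-dec (all? λ a → f a a ≟ᴮ false)
       ×-dec (all? λ a → length (filterᵇ (f a) (allFin 6)) ≟ℕ 3)

graph : (f : V → V → Bool) {ok : True (isCubic? f)} → Graph
graph f {ok} with toWitness ok
... | s , i , c = record { adj = f ; sym = s ; irr = i ; cubic = c }

edges : List (V × V) → V → V → Bool
edges es a b = any (λ (p , q) → (does (a ≟ p) ∧ does (b ≟ q)) ∨ (does (a ≟ q) ∧ does (b ≟ p))) es

record Iso (σ : Permutation′ 6) (G G' : Graph) : Set where
  constructor iso
  field preserves : ∀ a b → E G' (σ ⟨$⟩ʳ a) (σ ⟨$⟩ʳ b) ⇔ E G a b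
open Iso

⟨$⟩ʳ-injective : (σ : Permutation′ 6) {a b : V} → σ ⟨$⟩ʳ a ≡ σ ⟨$⟩ʳ b → a ≡ b
⟨$⟩ʳ-injective σ {a} {b} eq =
  ≡.trans (≡.sym (inverseˡ σ)) (≡.trans (cong (σ ⟨$⟩ˡ_) eq) (inverseˡ σ))

on-images : (σ : Permutation′ 6) {P : V → V → Set} →
  (∀ a b → P (σ ⟨$⟩ʳ a) (σ ⟨$⟩ʳ b)) → ∀ a b → P a b
on-images σ {P} h a b = subst₂ P (inverseʳ σ) (inverseʳ σ) (h (σ ⟨$⟩ˡ a) (σ ⟨$⟩ˡ b))

¬-⇔ : {A B : Set} → A ⇔ B → (¬ A) ⇔ (¬ B)
¬-⇔ e = mk⇔ (λ ¬a → ¬a ∘ from e) (λ ¬b → ¬b ∘ to e)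

≡-iso : (σ : Permutation′ 6) {a b : V} → (σ ⟨$⟩ʳ a ≡ σ ⟨$⟩ʳ b) ⇔ (a ≡ b)
≡-iso σ = mk⇔ (⟨$⟩ʳ-injective σ) (cong (σ ⟨$⟩ʳ_))

module _ (σ : Permutation′ 6) where
  private
    infix 10 ⟦_⟧
    ⟦_⟧ : V → V
    ⟦ a ⟧ = σ ⟨$⟩ʳ a

  samePair-iso : ∀ {a b p q} → SamePair ⟦ a ⟧ ⟦ b ⟧ ⟦ p ⟧ ⟦ q ⟧ ⇔ SamePair a b p q
  samePair-iso = (≡-iso σ ×-⇔ ≡-iso σ) ⊎-⇔ (≡-iso σ ×-⇔ ≡-iso σ)

  distinct-iso : ∀ {a b} → a ≢ b → ⟦ a ⟧ ≢ ⟦ b ⟧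
  distinct-iso a≢b = a≢b ∘ ⟨$⟩ʳ-injective σ

  module _ {G G' : Graph} (isoG : Iso σ G G') where
    edge-iso : ∀ a b → E G a b → E G' ⟦ a ⟧ ⟦ b ⟧
    edge-iso a b = from (preserves isoG a b)

    nonedge-iso : ∀ a b → ¬ E G a b → ¬ E G' ⟦ a ⟧ ⟦ b ⟧
    nonedge-iso a b ¬e = ¬e ∘ to (preserves isoG a b)

    replaces-iso : ∀ {H H' p₁ q₁ p₂ q₂ r₁ s₁ r₂ s₂} → Iso σ H H' →
      Replaces G H p₁ q₁ p₂ q₂ r₁ s₁ r₂ s₂ →
      Replaces G' H' ⟦ p₁ ⟧ ⟦ q₁ ⟧ ⟦ p₂ ⟧ ⟦ q₂ ⟧ ⟦ r₁ ⟧ ⟦ s₁ ⟧ ⟦ r₂ ⟧ ⟦ s₂ ⟧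
    replaces-iso isoH r = on-images σ λ a b →
      ⇔.trans (preserves isoH a b) (⇔.trans (r a b) (⇔.sym
        ((preserves isoG a b ×-⇔ ¬-⇔ samePair-iso ×-⇔ ¬-⇔ samePair-iso)
          ⊎-⇔ samePair-iso ⊎-⇔ samePair-iso)))

    distinct5-iso : ∀ {a b c d e} → Distinct5 a b c d e → Distinct5 ⟦ a ⟧ ⟦ b ⟧ ⟦ c ⟧ ⟦ d ⟧ ⟦ e ⟧
    distinct5-iso (d₁ , d₂ , d₃ , d₄ , d₅ , d₆ , d₇ , d₈ , d₉ , d₁₀) =
      distinct-iso d₁ , distinct-iso d₂ , distinct-iso d₃ , distinct-iso d₄ , distinct-iso d₅ ,
      distinct-iso d₆ , distinct-iso d₇ , distinct-iso d₈ , distinct-iso d₉ , distinct-iso d₁₀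

    make-iso : ∀ {H H' y x v w z} → Iso σ H H' →
      Make G y x v w z H → Make G' ⟦ y ⟧ ⟦ x ⟧ ⟦ v ⟧ ⟦ w ⟧ ⟦ z ⟧ H'
    make-iso {y = y} {x} {v} {w} {z} isoH (d , e₁ , e₂ , e₃ , e₄ , n₁ , n₂ , r) =
      distinct5-iso d , edge-iso y x e₁ , edge-iso x v e₂ , edge-iso v w e₃ , edge-iso w z e₄ ,
      nonedge-iso x w n₁ , nonedge-iso y z n₂ , replaces-iso isoH r

    break-iso : ∀ {H H' v x w y z} → Iso σ H H' →
      Break G v x w y z H → Break G' ⟦ v ⟧ ⟦ x ⟧ ⟦ w ⟧ ⟦ y ⟧ ⟦ z ⟧ H'
    break-iso {v = v} {x} {w} {y} {z} isoH
              ((d₁ , d₂ , d₃ , e₁ , e₂ , e₃) , e₄ , (d₄ , d₅ , d₆ , d₇ , d₈ , d₉) , n₁ , n₂ , r) =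
      (distinct-iso d₁ , distinct-iso d₂ , distinct-iso d₃ ,
       edge-iso v x e₁ , edge-iso x w e₂ , edge-iso w v e₃) ,
      edge-iso y z e₄ ,
      (distinct-iso d₄ , distinct-iso d₅ , distinct-iso d₆ , distinct-iso d₇ , distinct-iso d₈ , distinct-iso d₉) ,
      nonedge-iso x y n₁ , nonedge-iso w z n₂ , replaces-iso isoH r

  move-iso : ∀ {G G' H H'} → Iso σ G G' → Iso σ H H' → Move G H → Move G' H'
  move-iso isoG isoH (inj₁ (y , x , v , w , z , m)) =
    inj₁ (⟦ y ⟧ , ⟦ x ⟧ , ⟦ v ⟧ , ⟦ w ⟧ , ⟦ z ⟧ , make-iso isoG isoH m)
  move-iso isoG isoH (inj₂ (v , x , w , y , z , b)) =
    inj₂ (⟦ v ⟧ , ⟦ x ⟧ , ⟦ w ⟧ , ⟦ y ⟧ , ⟦ z ⟧ , break-iso isoG isoH b)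

  adj-iso : ∀ {G G' H H'} → Iso σ G G' → Iso σ H H' → Adj* G H → Adj* G' H'
  adj-iso isoG isoH (inj₁ m) = inj₁ (move-iso isoG isoH m)
  adj-iso isoG isoH (inj₂ m) = inj₂ (move-iso isoH isoG m)

-- Two graphs with the same edges (graphs are records, so this is weaker than ≡).
_≐_ : Graph → Graph → Set
G ≐ H = ∀ a b → E G a b ⇔ E H a b

≐⇒iso-id : {G G' : Graph} → G ≐ G' → Iso id G G'
≐⇒iso-id eq = iso λ a b → ⇔.sym (eq a b)

iso-refl : {G : Graph} → Iso id G G
iso-refl = iso λ a b → ⇔.refl

iso-∘ : ∀ {α β G G' G''} → Iso α G G' → Iso β G' G'' → Iso (α ∘ₚ β) G G''
iso-∘ {α} i j = iso λ a b → ⇔.trans (preserves j (α ⟨$⟩ʳ a) (α ⟨$⟩ʳ b)) (preserves i a b)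

iso-unique : ∀ {σ G X Y} → Iso σ G X → Iso σ G Y → X ≐ Y
iso-unique {σ} i j = on-images σ λ a b → ⇔.trans (preserves i a b) (⇔.sym (preserves j a b))

module ℕ-Sum = Algebra.Properties.CommutativeMonoid.Sum +-0-commutativeMonoid

indicator : Bool → ℕ
indicator b = if b then 1 else 0

count-tabulate : ∀ {n} {A : Set} (p : A → Bool) (f : Fin n → A) →
  length (filterᵇ p (tabulate f)) ≡ ℕ-Sum.sum (λ i → indicator (p (f i)))
count-tabulate {zero}  p f = refl
count-tabulate {suc n} p f with p (f Fin.zero)
... | true  = cong suc (count-tabulate p (f ∘ Fin.suc))
... | false = count-tabulate p (f ∘ Fin.suc)

count-permute : ∀ {n} (ρ : Permutation′ n) (p : Fin n → Bool) →
  length (filterᵇ (p ∘ (ρ ⟨$⟩ʳ_)) (allFin n)) ≡ length (filterᵇ p (allFin n))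
count-permute ρ p = begin
  length (filterᵇ (p ∘ (ρ ⟨$⟩ʳ_)) (allFin _)) ≡⟨ count-tabulate (p ∘ (ρ ⟨$⟩ʳ_)) Function.id ⟩
  ℕ-Sum.sum (indicator ∘ p ∘ (ρ ⟨$⟩ʳ_))      ≡⟨ ≡.sym (ℕ-Sum.sum-permute (indicator ∘ p) ρ) ⟩
  ℕ-Sum.sum (indicator ∘ p)                   ≡⟨ ≡.sym (count-tabulate p Function.id) ⟩
  length (filterᵇ p (allFin _))               ∎
  where open ≡.≡-Reasoning

relabel : Permutation′ 6 → Graph → Graph
relabel σ G = record
  { adj   = λ a b → adj G (σ ⟨$⟩ˡ a) (σ ⟨$⟩ˡ b)
  ; sym   = λ a b → sym G (σ ⟨$⟩ˡ a) (σ ⟨$⟩ˡ b)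
  ; irr   = λ a → irr G (σ ⟨$⟩ˡ a)
  ; cubic = λ a → ≡.trans (count-permute (flip σ) (adj G (σ ⟨$⟩ˡ a))) (cubic G (σ ⟨$⟩ˡ a))
  }

relabel-iso : (σ : Permutation′ 6) (G : Graph) → Iso σ G (relabel σ G)
relabel-iso σ G = iso λ a b →
  subst₂ (λ c d → E G c d ⇔ E G a b) (≡.sym (inverseˡ σ)) (≡.sym (inverseˡ σ)) ⇔.refl

relabel-path : ∀ σ {G G' H} → Connected* G H → Iso σ G G' →
  Σ Graph λ H' → Iso σ H H' × Connected* G' H'
relabel-path σ ε i = _ , i , ε
relabel-path σ {G' = G'} (_◅_ {j = M} step path) i with relabel-path σ path (relabel-iso σ M)
... | H' , i' , path' = H' , i' , adj-iso σ i (relabel-iso σ M) step ◅ path'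

adj-sym : ∀ {G H} → Adj* G H → Adj* H G
adj-sym = swap

connected-sym : ∀ {G H} → Connected* G H → Connected* H G
connected-sym = reverse (λ {X} {Y} → adj-sym {X} {Y})

-- A path may be redirected to end at an equal graph.  If it is empty the
-- endpoint is reached by stepping to a neighbour and back.
retarget : ∀ {G N X H} → Adj* G N → Connected* G X → X ≐ H → Connected* G H
retarget {G} {N} {_} {H} step ε eq =
  G ⟶⟨ step ⟩
  N ⟶⟨ adj-iso id (iso-refl {N}) (≐⇒iso-id {G} {H} eq) (adj-sym {G} {N} step) ⟩
  H ■
retarget {G} _ (_◅_ {j = M} step path) eq = G ⟶⟨ step ⟩ retarget {M} {G} (adj-sym {G} {M} step) path eq

side : V → Bool
side a = toℕ a <ᵇ 3

K₀ : Graph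
K₀ = graph (λ a b → side a xor side b)

K₀-spec : ∀ a b → E K₀ a b ⇔ K33 a b
K₀-spec = from-yes (all? λ a → all? λ b → edge? K₀ a b ⇔? k33? a b)
  where
  k33? : ∀ a b → Dec (K33 a b)
  k33? a b = (toℕ a <? 3 ×-dec ¬? (toℕ b <? 3)) ⊎-dec (¬? (toℕ a <? 3) ×-dec toℕ b <? 3)

iso? : (σ : Permutation′ 6) (G G' : Graph) → Dec (Iso σ G G')
iso? σ G G' = map′ iso preserves
  (all? λ a → all? λ b → edge? G' (σ ⟨$⟩ʳ a) (σ ⟨$⟩ʳ b) ⇔? edge? G a b)

Reachable : Permutation′ 6 → Set
Reachable σ = Σ Graph λ X → Iso σ K₀ X × Connected* K₀ X

-- A relabelling fixing K₀, i.e. one preserving or exchanging its two sides.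
Automorphism : Permutation′ 6 → Set
Automorphism α = Iso α K₀ K₀

reachable-aut : ∀ {α} → Automorphism α → Reachable α
reachable-aut aut = K₀ , aut , ε

-- Reachable permutations are closed under composition: relabel the path
-- realising α along β, starting from the end of the path realising β.
reachable-∘ : ∀ {α β} → Reachable α → Reachable β → Reachable (α ∘ₚ β)
reachable-∘ {β = β} (Xα , isoα , pathα) (Xβ , isoβ , pathβ) =
  let Y , isoY , path = relabel-path β pathα isoβ in Y , iso-∘ isoα isoY , pathβ ◅◅ path

reachable-cong : ∀ {σ ρ} → σ ≈ₚ ρ → Reachable σ → Reachable ρ
reachable-cong σ≈ρ (X , isoX , path) =
  X , iso (λ a b → subst₂ (λ c d → E X c d ⇔ E K₀ a b) (σ≈ρ a) (σ≈ρ b) (preserves isoX a b)) , path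

swap23 : Permutation′ 6
swap23 = transpose 2F 3F

-- The graph obtained from K₀ by make(0,3,1,4,2), which trades the edges
-- 03, 24 of K₀ for 34, 02.
K₀′ : Graph
K₀′ = graph (edges ((# 0 , # 2) ∷ (# 0 , # 4) ∷ (# 0 , # 5) ∷ (# 1 , # 3) ∷ (# 1 , # 4) ∷
                     (# 1 , # 5) ∷ (# 2 , # 3) ∷ (# 2 , # 5) ∷ (# 3 , # 4) ∷ []))

swap23-reachable : Reachable swap23
swap23-reachable =
  relabel swap23 K₀ , relabel-iso swap23 K₀ ,
  (K₀                 ⟶⟨ make⟶ K₀ (# 0) (# 3) (# 1) (# 4) (# 2) K₀′ ⟩
   K₀′                ⟶⟨ break⟶ K₀′ (# 0) (# 2) (# 5) (# 1) (# 3) (relabel swap23 K₀) ⟩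
   relabel swap23 K₀  ■)

-- An automorphism of K₀ carrying i ↦ 2 and j ↦ 3 when i and j lie on
-- different sides.
conjugator : V → V → Permutation′ 6
conjugator i j =
  if side i then transpose 2F i ∘ₚ transpose 3F j else transpose 2F j ∘ₚ transpose 3F i

transposition-cases : ∀ i j →
  Automorphism (transpose i j)
  ⊎ (Automorphism (conjugator i j)
     × conjugator i j ∘ₚ swap23 ∘ₚ conjugator i j ≈ₚ transpose i j)
transposition-cases = from-yes (all? λ i → all? λ j →
  iso? (transpose i j) K₀ K₀
  ⊎-dec (iso? (conjugator i j) K₀ K₀
         ×-dec all? λ k → (conjugator i j ∘ₚ swap23 ∘ₚ conjugator i j) ⟨$⟩ʳ k ≟ transpose i j ⟨$⟩ʳ k))

transposition-reachable : ∀ i j → Reachable (transpose i j)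
transposition-reachable i j = [ reachable-aut , via-conjugation ]′ (transposition-cases i j)
  where
  α : Permutation′ 6
  α = conjugator i j

  via-conjugation : Automorphism α × α ∘ₚ swap23 ∘ₚ α ≈ₚ transpose i j → Reachable (transpose i j)
  via-conjugation (aut , conj≈) =
    reachable-cong conj≈ (reachable-∘ (reachable-aut aut) (reachable-∘ swap23-reachable (reachable-aut aut)))

-- Transpositions generate the symmetric group, so every permutation is reachable.
reachable-eval : (ts : TranspositionList 6) → Reachable (eval ts)
reachable-eval []             = reachable-aut iso-refl
reachable-eval ((i , j) ∷ ts) = reachable-∘ (transposition-reachable i j) (reachable-eval ts)

every-reachable : ∀ σ → Reachable σ
every-reachable σ = reachable-cong (eval-decompose σ) (reachable-eval (decompose σ))

-- If σ is reachable then K₀ is joined to every σ-relabelling of K₀ (not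
-- only to the one the path happens to end at).
reachable⇒connected : ∀ {σ G} → Reachable σ → Iso σ K₀ G → Connected* K₀ G
reachable⇒connected (X , isoX , path) isoG =
  retarget {N = K₀′} (make⟶ K₀ (# 0) (# 3) (# 1) (# 4) (# 2) K₀′) path (iso-unique isoX isoG)

connected-to-K₀ : ∀ G → IsK33 G → Connected* K₀ G
connected-to-K₀ G (π , isoπ) = reachable⇒connected (every-reachable π) isoG
  where
  isoG : Iso π K₀ G
  isoG = iso λ a b → ⇔.trans (isoπ a b) (⇔.sym (K₀-spec a b))

lemma11 : (G H : Graph) → IsK33 G → IsK33 H → Connected* G H
lemma11 G H G∈𝒜 H∈𝒜 = connected-sym (connected-to-K₀ G G∈𝒜) ◅◅ connected-to-K₀ H H∈𝒜
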